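{- Let $\mathsf{Boxes}$ and $\mathsf{Inputs}$ be types, $\mathsf{Arity} : \mathsf{Boxes}\to\mathsf{Type}$, and for each $b:\mathsf{Boxes}$, $a:\mathsf{Arity}(b)$, $i:\mathsf{Inputs}$ let $\mathsf{Dom}(b,a)$, $\mathsf{Cod}(b)$, $\mathsf{inputs}(i)$ be polynomials equipped with specifications (dependent polynomials) $\rho_{b,a}$ over $\mathsf{Dom}(b,a)$, $\sigma_b$ over $\mathsf{Cod}(b)$ and $\iota_i$ over $\mathsf{inputs}(i)$. Let $p$ be a polynomial with a dependent polynomial $\tau$ over $p$, and let $W : \mathsf{SWiring}(p,\tau)$ be a specified wiring diagram, with underlying wiring diagram $|W| : \mathsf{Wiring}(p)$. Suppose that for each $b:\mathsf{Boxes}$ we are given an implementation $g_b : \mathsf{Cod}(b) \Rightarrow \mathsf{Free}(\mathsf{sum}\,(\mathsf{Arity}\,b)\,(\mathsf{Dom}\,b))$ together with a verification of $g_b$ with respect to the specification $\sigma_b$ on $\mathsf{Cod}(b)$ and the specification $\mathsf{sumDep}\,(\mathsf{Arity}\,b)\,(\mathsf{Dom}\,b)\,(\rho_{b,- })$ on $\mathsf{sum}\,(\mathsf{Arity}\,b)\,(\mathsf{Dom}\,b)$. Then there is a verification of the composite implementation $\mathsf{compose}(|W|, g) : p \Rightarrow \mathsf{Free}(\mathsf{sum}\,\mathsf{Inputs}\,\mathsf{inputs})$ with respect to the specification $\tau$ on $p$ and the specification $\mathsf{sumDep}\,\mathsf{Inputs}\,\mathsf{inputs}\,\iota$ on $\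mathsf{sum}\,\mathsf{Inputs}\,\mathsf{inputs}$.
   Context: Work in dependent type theory with universe $\mathsf{Type}$. A polynomial is a pair $p=(A,B)$ with $A$ a type and $B:A\to\mathsf{Type}$. For $F:\mathsf{Type}\to\mathsf{Type}$, $(A,B)\Rightarrow F := \prod_{a:A}F(B(a))$. The free monad $\mathsf{Free}\,p\,C$ (for $p=(A,B)$) is the inductive type with constructors $\mathsf{return}: C\to \mathsf{Free}\,p\,C$ and $\mathsf{bind}:\prod_{a:A}(B(a)\to\mathsf{Free}\,p\,C)\to\mathsf{Free}\,p\,C$. Monadic bind: $(\mathsf{return}\,c)\gg\!= h = h(c)$, $(\mathsf{bind}\,a\,k)\gg\!= h = \mathsf{bind}\,a\,(\lambda b.\,k(b)\gg\!= h)$. For $e:\mathsf{Free}\,p\,E$ and $g : p\Rightarrow\mathsf{Free}\,q$ define $\mathsf{subst}(\mathsf{return}\,e,g)=\mathsf{return}\,e$ and $\mathsf{subst}(\mathsf{bind}\,a\,k,g)= g(a)\gg\!=(\lambda b.\,\mathsf{subst}(k(b),g))$; Kleisli composition of $f:p\Rightarrow\mathsf{Free}\,q$ and $g:q\Rightarrow\mathsf{Free}\,r$ is $f\circ g := \lambda a.\,\mathsf{subst}(f(a),g)$. For a type $U$ and polynomials $P(u)=(A_u,B_u)$, $\mathsf{sum}\,U\,P=(\sum_{u:U}A_u,\ (u,x)\mapsto B_u(x))$; for $f:p\Rightarrow\mathsf{Free}(\mathsf{sum}\,U\,P)$ and $g:\prod_{u:U} P(u)\Rightarrow\mathsf{Free}\,r$,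 $\mathsf{comp}\,U\,f\,g := f\circ(\lambda(u,x).\,g\,u\,x)$. Wiring diagrams: given the box data, $\mathsf{Wiring}(o)$ ($o$ a polynomial) is inductively generated by $\mathsf{wire}(i):\mathsf{Wiring}(\mathsf{inputs}(i))$ and $\mathsf{box}(b,f):\mathsf{Wiring}(\mathsf{Cod}(b))$ for $f:\prod_{a:\mathsf{Arity}(b)}\mathsf{Wiring}(\mathsf{Dom}(b,a))$. Given implementations $g_b$ as in the claim, $\mathsf{compose}(W,g) : o \Rightarrow \mathsf{Free}(\mathsf{sum}\,\mathsf{Inputs}\,\mathsf{inputs})$ is defined recursively by $\mathsf{compose}(\mathsf{wire}(i),g) = \lambda x.\,\mathsf{bind}\,(i,x)\,\mathsf{return}$ and $\mathsf{compose}(\mathsf{box}(b,f),g)=\mathsf{comp}\,(\mathsf{Arity}\,b)\,g_b\,(\lambda a.\,\mathsf{compose}(f(a),g))$. Specifications: a dependent polynomial over $p=(A,B)$ is a pair $(C,D)$ with $C:A\to\mathsf{Type}$ (preconditions) and $D:\prod_{a:A}C(a)\to B(a)\to\mathsf{Type}$ (postconditions). For dependent polynomials $r_u=(C_u,D_u)$ over $P(u)$, $\mathsf{sumDep}\,U\,P\,r$ is the dependent polynomial over $\mathsf{sum}\,U\,P$ with preconditions $(u,x)\mapsto C_u(x)$ and postconditions $(u,x),y,z\mapsto D_u(x,y,z)$. For $p=(A,B)$, a dependent polynomial $s$ over $p$, a type $E$ and $F:E\to\mathsf{Type}$, $\mathsf{FreeDep}\,p\,s\,E\,F : \mathsf{Free}\,p\,E\to\mathsf{Type}$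 is the inductive family with constructors $\mathsf{returnD}: F(e)\to\mathsf{FreeDep}\,p\,s\,E\,F(\mathsf{return}\,e)$ and, for $a:A$, $c:C(a)$, $k:B(a)\to\mathsf{Free}\,p\,E$, $\mathsf{bindD}\,c : \big(\prod_{b:B(a)} D(a,c,b)\to\mathsf{FreeDep}\,p\,s\,E\,F(k(b))\big)\to\mathsf{FreeDep}\,p\,s\,E\,F(\mathsf{bind}\,a\,k)$ (where $s=(C,D)$). Given $f:p\Rightarrow\mathsf{Free}\,q$, a specification $r=(C,D)$ on $p=(A,B)$ and $s$ on $q$, a verification of $f$ with respect to $r$ and $s$ is an element of $\prod_{a:A}\prod_{c:C(a)}\mathsf{FreeDep}\,q\,s\,(B(a))\,(D(a,c))\,(f(a))$. Specified wiring diagrams: given the data in the claim, $\mathsf{SWiring}(o,t)$ (for a polynomial $o$ and dependent polynomial $t$ over $o$) is inductively generated by $\mathsf{swire}(i):\mathsf{SWiring}(\mathsf{inputs}(i),\iota_i)$ and $\mathsf{sbox}(b,f):\mathsf{SWiring}(\mathsf{Cod}(b),\sigma_b)$ for $f:\prod_{a:\mathsf{Arity}(b)}\mathsf{SWiring}(\mathsf{Dom}(b,a),\rho_{b,a})$; its underlying wiring diagram $|W|$ is obtained by replacing $\mathsf{swire}$ by $\mathsf{wire}$ and $\mathsf{sbox}$ by $\mathsf{box}$ recursively. -}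

module Defs where

open import Data.Product using (Σ; _,_; proj₁; proj₂)

record Poly : Set₁ where
  constructor poly
  field
    Pos : Set
    Dir : Pos → Set
open Poly public

_⇒_ : Poly → (Set → Set) → Set
p ⇒ F = (a : Pos p) → F (Dir p a)

data Free (p : Poly) (C : Set) : Set where
  return : C → Free p C
  bind   : (a : Pos p) → (Dir p a → Free p C) → Free p C

_>>=_ : ∀ {p C D} → Free p C → (C → Free p D) → Free p D
return c >>= h = h c
bind a k >>= h = bind a (λ b → k b >>= h)

subst : ∀ {p q E} → Free p E → (p ⇒ Free q) → Free q E
subst (return e) g = return e
subst (bind a k) g = g a >>= (λ b → subst (k b) g)

_∘K_ : ∀ {p q r} → (p ⇒ Free q) → (q ⇒ Free r) → p ⇒ Free r
(f ∘K g) a = subst (f a) g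

sum : (U : Set) → (U → Poly) → Poly
sum U P = poly (Σ U (λ u → Pos (P u))) (λ { (u , x) → Dir (P u) x })

comp : ∀ {p r} (U : Set) {P : U → Poly} →
       (p ⇒ Free (sum U P)) → ((u : U) → P u ⇒ Free r) → p ⇒ Free r
comp U f g = f ∘K (λ { (u , x) → g u x })

record DepPoly (p : Poly) : Set₁ where
  constructor dpoly
  field
    Pre  : Pos p → Set
    Post : (a : Pos p) → Pre a → Dir p a → Set
open DepPoly public

sumDep : (U : Set) (P : U → Poly) → ((u : U) → DepPoly (P u)) → DepPoly (sum U P)
sumDep U P r = dpoly (λ { (u , x) → Pre (r u) x })
                     (λ { (u , x) y z → Post (r u) x y z })

data FreeDep (p : Poly) (s : DepPoly p) (E : Set) (F : E → Set) : Free p E → Set where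
  returnD : ∀ {e} → F e → FreeDep p s E F (return e)
  bindD   : ∀ {a} {k : Dir p a → Free p E} (c : Pre s a) →
            ((b : Dir p a) → Post s a c b → FreeDep p s E F (k b)) →
            FreeDep p s E F (bind a k)

Verification : (p q : Poly) → (p ⇒ Free q) → DepPoly p → DepPoly q → Set
Verification p q f r s =
  (a : Pos p) (c : Pre r a) → FreeDep q s (Dir p a) (Post r a c) (f a)

record BoxData : Set₁ where
  field
    Boxes  : Set
    Inputs : Set
    Arity  : Boxes → Set
    Dom    : (b : Boxes) → Arity b → Poly
    Cod    : Boxes → Poly
    inputs : Inputs → Poly

module Wirings (D : BoxData) where
  open BoxData D

  data Wiring : Poly → Set₁ where
    wire : (i : Inputs) → Wiring (inputs i)
    box  : (b : Boxes) → ((a : Arity b) → Wiring (Dom b a)) → Wiring (Cod b)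

  compose : ∀ {o} → Wiring o →
            ((b : Boxes) → Cod b ⇒ Free (sum (Arity b) (Dom b))) →
            o ⇒ Free (sum Inputs inputs)
  compose (wire i)  g = λ x → bind (i , x) return
  compose (box b f) g = comp (Arity b) (g b) (λ a → compose (f a) g)

  module Specified
    (ρ : (b : Boxes) (a : Arity b) → DepPoly (Dom b a))
    (σ : (b : Boxes) → DepPoly (Cod b))
    (ι : (i : Inputs) → DepPoly (inputs i)) where

    data SWiring : (o : Poly) → DepPoly o → Set₁ where
      swire : (i : Inputs) → SWiring (inputs i) (ι i)
      sbox  : (b : Boxes) → ((a : Arity b) → SWiring (Dom b a) (ρ b a)) →
              SWiring (Cod b) (σ b)

    ∣_∣ : ∀ {o t} → SWiring o t → Wiring o
    ∣ swire i ∣  = wire i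
    ∣ sbox b f ∣ = box b (λ a → ∣ f a ∣)

module Submission where

-- A verification is a proof-relevant Hoare logic for the free monad: verified
-- programs are closed under monadic bind, hence under substitution, hence under
-- Kleisli composition. Composing a specified wiring diagram is an iterated
-- Kleisli composition, so verifications of the boxes assemble, by induction on
-- the diagram, into a verification of the whole.

open import Defs
open import Data.Product using (_,_)

>>=-verified : ∀ {q s E E′} {F : E → Set} {F′ : E′ → Set}
  {m : Free q E} {h : E → Free q E′} →
  FreeDep q s E F m → ((e : E) → F e → FreeDep q s E′ F′ (h e)) →
  FreeDep q s E′ F′ (m >>= h)
>>=-verified (returnD x) vh = vh _ x
>>=-verified (bindD c k) vh = bindD c (λ b d → >>=-verified (k b d) vh)

subst-verified : ∀ {p q r s E} {F : E → Set} {m : Free p E} {g : p ⇒ Free q} →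
  FreeDep p r E F m → Verification p q g r s → FreeDep q s E F (subst m g)
subst-verified (returnD x) vg = returnD x
subst-verified (bindD c k) vg = >>=-verified (vg _ c) (λ b d → subst-verified (k b d) vg)

∘K-verified : ∀ {p q r} {sp : DepPoly p} {sq : DepPoly q} {sr : DepPoly r}
  {f : p ⇒ Free q} {g : q ⇒ Free r} →
  Verification p q f sp sq → Verification q r g sq sr →
  Verification p r (f ∘K g) sp sr
∘K-verified vf vg a c = subst-verified (vf a c) vg

comp-verified : ∀ {p r} (U : Set) {P : U → Poly}
  {sp : DepPoly p} {sP : (u : U) → DepPoly (P u)} {sr : DepPoly r}
  {f : p ⇒ Free (sum U P)} {g : (u : U) → P u ⇒ Free r} →
  Verification p (sum U P) f sp (sumDep U P sP) →
  ((u : U) → Verification (P u) r (g u) (sP u) sr) →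
  Verification p r (comp U f g) sp sr
comp-verified U vf vg = ∘K-verified vf (λ { (u , x) → vg u x })

module _ (D : BoxData) where
  open BoxData D
  open Wirings D

  module _ (ρ : (b : Boxes) (a : Arity b) → DepPoly (Dom b a))
           (σ : (b : Boxes) → DepPoly (Cod b))
           (ι : (i : Inputs) → DepPoly (inputs i))
           {g : (b : Boxes) → Cod b ⇒ Free (sum (Arity b) (Dom b))}
           (vg : (b : Boxes) → Verification (Cod b) (sum (Arity b) (Dom b)) (g b)
                   (σ b) (sumDep (Arity b) (Dom b) (ρ b))) where
    open Specified ρ σ ι

    compose-verified : ∀ {o t} (W : SWiring o t) →
      Verification o (sum Inputs inputs) (compose ∣ W ∣ g) t (sumDep Inputs inputs ι)
    compose-verified (swire i)  x c = bindD c (λ _ d → returnD d)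
    compose-verified (sbox b f) =
      comp-verified (Arity b) (vg b) (λ a → compose-verified (f a))

theorem2 : (D : BoxData) →
    let open BoxData D in
    (ρ : (b : Boxes) (a : Arity b) → DepPoly (Dom b a)) →
    (σ : (b : Boxes) → DepPoly (Cod b)) →
    (ι : (i : Inputs) → DepPoly (inputs i)) →
    (p : Poly) (τ : DepPoly p) →
    (W : Wirings.Specified.SWiring D ρ σ ι p τ) →
    (g : (b : Boxes) → Cod b ⇒ Free (sum (Arity b) (Dom b))) →
    (vg : (b : Boxes) → Verification (Cod b) (sum (Arity b) (Dom b)) (g b)
            (σ b) (sumDep (Arity b) (Dom b) (ρ b))) →
    Verification p (sum Inputs inputs)
      (Wirings.compose D (Wirings.Specified.∣_∣ D ρ σ ι W) g)
      τ (sumDep Inputs inputs ι)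
theorem2 D ρ σ ι p τ W g vg = compose-verified D ρ σ ι vg W
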